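{- For every $n\ge 3$, the complete graph $K_n$ satisfies $\mathrm{Maj}'(K_n)\le 3$.
   Context: Two distinct edges are adjacent if they share an endpoint. An edge-coloring $c:E\to C$ (not necessarily proper) of a graph $G=(V,E)$ is a strong majority edge-coloring if for every edge $e\in E$ and every color $\alpha\in C$, at most half of the edges adjacent to $e$ have color $\alpha$. The strong majority index $\mathrm{Maj}'(G)$ is the least number of colors in such a coloring. -}

module Defs where

open import Data.Nat using (ℕ; _*_; _≤_)
open import Data.Fin using (Fin; _<?_) renaming (_<_ to _<ᶠ_)
open import Data.Fin.Properties using (_≟_)
open import Data.List using (List; length; filter; concatMap; mapMaybe; allFin)
open import Data.Maybe using (Maybe; just; nothing)
open import Data.Product using (Σ; _×_; _,_; proj₁; proj₂; ∃)
open import Data.Sum using (_⊎_)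
open import Relation.Nullary using (¬_; Dec; yes; no)
open import Relation.Nullary.Decidable using (_×-dec_; _⊎-dec_; ¬?)
open import Relation.Binary.PropositionalEquality using (_≡_)

-- An edge of the complete graph K_n on vertex set Fin n:
-- an unordered pair {u, v}, represented uniquely as (u , v) with u < v.
Edge : ℕ → Set
Edge n = Σ (Fin n × Fin n) (λ p → proj₁ p <ᶠ proj₂ p)

lo hi : ∀ {n} → Edge n → Fin n
lo e = proj₁ (proj₁ e)
hi e = proj₂ (proj₁ e)

edges : (n : ℕ) → List (Edge n)
edges n = concatMap (λ u → mapMaybe (pick u) (allFin n)) (allFin n)
  where
  pick : Fin n → Fin n → Maybe (Edge n)
  pick u v with u <? v
  ... | yes u<v = just ((u , v) , u<v)
  ... | no  _   = nothing

ShareEnd : ∀ {n} → Edge n → Edge n → Set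
ShareEnd e f = (lo e ≡ lo f ⊎ lo e ≡ hi f) ⊎ (hi e ≡ lo f ⊎ hi e ≡ hi f)

SameEdge : ∀ {n} → Edge n → Edge n → Set
SameEdge e f = lo e ≡ lo f × hi e ≡ hi f

Adjacent : ∀ {n} → Edge n → Edge n → Set
Adjacent e f = ¬ SameEdge e f × ShareEnd e f

adjacent? : ∀ {n} (e f : Edge n) → Dec (Adjacent e f)
adjacent? e f =
  ¬? ((lo e ≟ lo f) ×-dec (hi e ≟ hi f))
  ×-dec (((lo e ≟ lo f) ⊎-dec (lo e ≟ hi f)) ⊎-dec ((hi e ≟ lo f) ⊎-dec (hi e ≟ hi f)))

adjDeg : ∀ {n} → Edge n → ℕ
adjDeg {n} e = length (filter (adjacent? e) (edges n))

adjColCount : ∀ {n k} → (Edge n → Fin k) → Edge n → Fin k → ℕ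
adjColCount {n} c e α =
  length (filter (λ f → adjacent? e f ×-dec (c f ≟ α)) (edges n))

StrongMajority : ∀ {n k} → (Edge n → Fin k) → Set
StrongMajority {n} {k} c =
  (e : Edge n) → (α : Fin k) → 2 * adjColCount c e α ≤ adjDeg e

MajIndexK≤ : ℕ → ℕ → Set
MajIndexK≤ n k = Σ (Edge n → Fin k) StrongMajority

-- Colour the edge {u, v} of K_n by u + v mod 3. The edges adjacent to e = {a, b} are the pairs
-- {a, x} and {b, x} with x ∉ e, 2(n − 2) of them, and colour α occurs Σ_{x ∉ e} ([a + x ≡ α] + [b + x ≡ α])
-- times. If a ≢ b (mod 3) every summand is at most 1. If a ≡ b every summand is 2 [x ≡ α − a], and a
-- residue class has at most ⌈n/3⌉ ≤ (n − 2)/2 elements once n ≥ 10. For 3 ≤ n ≤ 9 a colouring is checked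
-- by evaluation; the mod-3 colouring fails for n = 5 and n = 7, where explicit tables are used instead.
module Submission where

open import Defs
open import Data.Nat using (ℕ; zero; suc; _+_; _*_; _≤_; _≥_; z≤n; s≤s; _≤?_)
open import Data.Nat.Properties
  using (+-*-semiring; *-distribˡ-+; *-assoc; +-identityʳ; *-identityˡ; *-identityʳ; *-comm; *-distribʳ-+
        ; ≤-refl; ≤-trans; ≤-reflexive; +-mono-≤; +-monoʳ-≤; *-monoʳ-≤; *-cancelˡ-≤; +-comm; +-cancelʳ-≤
        ; m≤m+n; n≤1+n; module ≤-Reasoning)
open import Data.Nat.Tactic.RingSolver using (solve-∀)
open import Data.Fin using (Fin; toℕ; _<?_) renaming (zero to fzero; suc to fsuc; _<_ to _<ᶠ_)
open import Data.Fin.Properties using (_≟_; all?; <-irrelevant; <-irrefl; <-asym; <-cmp; <⇒≢)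
open import Data.List using (List; []; _∷_; length; filter; concatMap; mapMaybe; fromMaybe; allFin; tabulate)
open import Data.List.Properties using (filter-++; length-++; mapMaybe-concatMap)
open import Data.Maybe using (Maybe)
open import Data.Vec using (Vec; []; _∷_; lookup)
open import Data.Product using (_×_; _,_; proj₂)
open import Data.Sum using (_⊎_)
open import Function using (_∘_; id)
open import Relation.Nullary using (Dec; yes; no; ¬_; contradiction)
open import Relation.Nullary.Decidable using (_×-dec_; _⊎-dec_; _→-dec_; ¬?; map′; True; toWitness; from-yes)
open import Relation.Unary using (Pred; Decidable)
open import Relation.Binary.PropositionalEquality using (_≡_; refl; sym; trans; cong; cong₂; subst; module ≡-Reasoning)
open import Relation.Binary.Definitions using (tri<; tri≈; tri>)
open import Algebra.Properties.Semiring.Sum +-*-semiring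
  using (sum-syntax; sum-cong-≗; ∑-distrib-+; ∑-comm; *-distribˡ-sum; sum-replicate-zero)

-- Matching on the whole decision, not only on `does`, keeps [ u <? v ] stuck on u <? v
-- (instead of unfolding it to toℕ u <ᵇ toℕ v), so that `with u <? v` can abstract it.
[_] : ∀ {p} {P : Set p} → Dec P → ℕ
[ yes _ ] = 1
[ no _ ]  = 0

module _ {p q} {P : Set p} {Q : Set q} where

  []-×-dec : (p? : Dec P) (q? : Dec Q) → [ p? ×-dec q? ] ≡ [ p? ] * [ q? ]
  []-×-dec (yes _) (yes _) = refl
  []-×-dec (yes _) (no _)  = refl
  []-×-dec (no _)  (yes _) = refl
  []-×-dec (no _)  (no _)  = refl

  []-⊎-dec : ¬ (P × Q) → (p? : Dec P) (q? : Dec Q) → [ p? ⊎-dec q? ] ≡ [ p? ] + [ q? ]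
  []-⊎-dec ¬pq (yes p) (yes q) = contradiction (p , q) ¬pq
  []-⊎-dec _   (yes _) (no _)  = refl
  []-⊎-dec _   (no _)  (yes _) = refl
  []-⊎-dec _   (no _)  (no _)  = refl

  []+[]≤1 : ¬ (P × Q) → (p? : Dec P) (q? : Dec Q) → [ p? ] + [ q? ] ≤ 1
  []+[]≤1 ¬pq p? q? = subst (_≤ 1) ([]-⊎-dec ¬pq p? q?) ([]≤1 (p? ⊎-dec q?))
    where
    []≤1 : ∀ {r} {R : Set r} (r? : Dec R) → [ r? ] ≤ 1
    []≤1 (yes _) = ≤-refl
    []≤1 (no _)  = z≤n

module _ {p} {P : Set p} where

  []*m≤m : (p? : Dec P) (m : ℕ) → [ p? ] * m ≤ m
  []*m≤m (yes _) m = ≤-reflexive (+-identityʳ m)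
  []*m≤m (no _)  m = z≤n

  []*[¬]≡0 : (p? : Dec P) → [ p? ] * [ ¬? p? ] ≡ 0
  []*[¬]≡0 (yes _) = refl
  []*[¬]≡0 (no _)  = refl

∑-mono : ∀ {n} {f g : Fin n → ℕ} → (∀ i → f i ≤ g i) → ∑[ i < n ] f i ≤ ∑[ i < n ] g i
∑-mono {zero}  f≤g = z≤n
∑-mono {suc n} f≤g = +-mono-≤ (f≤g fzero) (∑-mono (f≤g ∘ fsuc))

∑-const-1 : ∀ n → ∑[ i < n ] 1 ≡ n
∑-const-1 zero    = refl
∑-const-1 (suc n) = cong suc (∑-const-1 n)

∑-[≟]* : ∀ {n} (a : Fin n) (g : Fin n → ℕ) → ∑[ u < n ] ([ a ≟ u ] * g u) ≡ g a
∑-[≟]* {suc n} fzero    g =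
  trans (cong (g fzero + 0 +_) (sum-replicate-zero n)) (trans (+-identityʳ _) (+-identityʳ _))
∑-[≟]* {suc n} (fsuc a) g =
  trans (sum-cong-≗ λ u → cong (_* g (fsuc u)) (suc≟suc a u)) (∑-[≟]* a (g ∘ fsuc))
  where
  suc≟suc : ∀ {n} (a u : Fin n) → [ fsuc a ≟ fsuc u ] ≡ [ a ≟ u ]
  suc≟suc a u with a ≟ u
  ... | yes _ = refl
  ... | no _  = refl

module _ {m n : ℕ} where

  ∑∑-cong : {f g : Fin m → Fin n → ℕ} → (∀ u v → f u v ≡ g u v) →
            ∑[ u < m ] ∑[ v < n ] f u v ≡ ∑[ u < m ] ∑[ v < n ] g u v
  ∑∑-cong f≡g = sum-cong-≗ (λ u → sum-cong-≗ (f≡g u))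

  ∑∑-distrib-+ : (f g : Fin m → Fin n → ℕ) →
                 ∑[ u < m ] ∑[ v < n ] (f u v + g u v)
                   ≡ ∑[ u < m ] ∑[ v < n ] f u v + ∑[ u < m ] ∑[ v < n ] g u v
  ∑∑-distrib-+ f g = trans (sum-cong-≗ (λ u → ∑-distrib-+ (f u) (g u)))
                           (∑-distrib-+ (λ u → ∑[ v < n ] f u v) (λ u → ∑[ v < n ] g u v))

∑-<-symmetrise : ∀ {n} (F : Fin n → Fin n → ℕ) → (∀ u → F u u ≡ 0) →
                 ∑[ u < n ] ∑[ v < n ] ([ u <? v ] * (F u v + F v u)) ≡ ∑[ u < n ] ∑[ v < n ] F u v
∑-<-symmetrise {n} F F-diag = begin
  ∑[ u < n ] ∑[ v < n ] ([ u <? v ] * (F u v + F v u))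
    ≡⟨ ∑∑-cong (λ u v → *-distribˡ-+ [ u <? v ] (F u v) (F v u)) ⟩
  ∑[ u < n ] ∑[ v < n ] ([ u <? v ] * F u v + [ u <? v ] * F v u)
    ≡⟨ ∑∑-distrib-+ (λ u v → [ u <? v ] * F u v) (λ u v → [ u <? v ] * F v u) ⟩
  ∑[ u < n ] ∑[ v < n ] ([ u <? v ] * F u v) + ∑[ u < n ] ∑[ v < n ] ([ u <? v ] * F v u)
    ≡⟨ cong (∑[ u < n ] ∑[ v < n ] ([ u <? v ] * F u v) +_) (∑-comm (λ u v → [ u <? v ] * F v u)) ⟩
  ∑[ u < n ] ∑[ v < n ] ([ u <? v ] * F u v) + ∑[ u < n ] ∑[ v < n ] ([ v <? u ] * F u v)
    ≡⟨ ∑∑-distrib-+ (λ u v → [ u <? v ] * F u v) (λ u v → [ v <? u ] * F u v) ⟨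
  ∑[ u < n ] ∑[ v < n ] ([ u <? v ] * F u v + [ v <? u ] * F u v)
    ≡⟨ ∑∑-cong split ⟩
  ∑[ u < n ] ∑[ v < n ] F u v ∎
  where
  open ≡-Reasoning
  split : ∀ u v → [ u <? v ] * F u v + [ v <? u ] * F u v ≡ F u v
  split u v with u <? v | v <? u
  ... | yes u<v | yes v<u = contradiction v<u (<-asym u<v)
  ... | yes _   | no _    = trans (+-identityʳ _) (+-identityʳ _)
  ... | no _    | yes _   = +-identityʳ _
  ... | no u≮v  | no v≮u with <-cmp u v
  ...   | tri< u<v _ _   = contradiction u<v u≮v
  ...   | tri≈ _ refl _  = sym (F-diag u)
  ...   | tri> _ _ v<u   = contradiction v<u v≮u

_∈ᵉ?_ : ∀ {n} (x : Fin n) (e : Edge n) → Dec (lo e ≡ x ⊎ hi e ≡ x)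
x ∈ᵉ? e = (lo e ≟ x) ⊎-dec (hi e ≟ x)

_∉ᵉ?_ : ∀ {n} (x : Fin n) (e : Edge n) → Dec (¬ (lo e ≡ x ⊎ hi e ≡ x))
x ∉ᵉ? e = ¬? (x ∈ᵉ? e)

module _ {n} (e : Edge n) where

  ∑-∈ᵉ : (g : Fin n → ℕ) → ∑[ x < n ] ([ x ∈ᵉ? e ] * g x) ≡ g (lo e) + g (hi e)
  ∑-∈ᵉ g = begin
    ∑[ x < n ] ([ x ∈ᵉ? e ] * g x)
      ≡⟨ sum-cong-≗ (λ x → cong (_* g x) (endpoints-distinct x)) ⟩
    ∑[ x < n ] (([ lo e ≟ x ] + [ hi e ≟ x ]) * g x)
      ≡⟨ sum-cong-≗ (λ x → *-distribʳ-+ (g x) [ lo e ≟ x ] [ hi e ≟ x ]) ⟩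
    ∑[ x < n ] ([ lo e ≟ x ] * g x + [ hi e ≟ x ] * g x)
      ≡⟨ ∑-distrib-+ (λ x → [ lo e ≟ x ] * g x) (λ x → [ hi e ≟ x ] * g x) ⟩
    ∑[ x < n ] ([ lo e ≟ x ] * g x) + ∑[ x < n ] ([ hi e ≟ x ] * g x)
      ≡⟨ cong₂ _+_ (∑-[≟]* (lo e) g) (∑-[≟]* (hi e) g) ⟩
    g (lo e) + g (hi e) ∎
    where
    open ≡-Reasoning
    endpoints-distinct : ∀ x → [ x ∈ᵉ? e ] ≡ [ lo e ≟ x ] + [ hi e ≟ x ]
    endpoints-distinct x =
      []-⊎-dec (λ (lo≡x , hi≡x) → <⇒≢ (proj₂ e) (trans lo≡x (sym hi≡x))) (lo e ≟ x) (hi e ≟ x)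

  ∑-∉ᵉ : ∑[ x < n ] [ x ∉ᵉ? e ] + 2 ≡ n
  ∑-∉ᵉ = begin
    ∑[ x < n ] [ x ∉ᵉ? e ] + 2
      ≡⟨ cong (∑[ x < n ] [ x ∉ᵉ? e ] +_) (∑-∈ᵉ (λ _ → 1)) ⟨
    ∑[ x < n ] [ x ∉ᵉ? e ] + ∑[ x < n ] ([ x ∈ᵉ? e ] * 1)
      ≡⟨ ∑-distrib-+ (λ x → [ x ∉ᵉ? e ]) (λ x → [ x ∈ᵉ? e ] * 1) ⟨
    ∑[ x < n ] ([ x ∉ᵉ? e ] + [ x ∈ᵉ? e ] * 1)
      ≡⟨ sum-cong-≗ ∉+∈ ⟩
    ∑[ x < n ] 1
      ≡⟨ ∑-const-1 n ⟩
    n ∎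
    where
    open ≡-Reasoning
    ∉+∈ : ∀ x → [ x ∉ᵉ? e ] + [ x ∈ᵉ? e ] * 1 ≡ 1
    ∉+∈ x with x ∈ᵉ? e
    ... | yes _ = refl
    ... | no _  = refl

adjacent-indicator : ∀ {n} (e f : Edge n) →
  [ adjacent? e f ] ≡ [ lo f ∈ᵉ? e ] * [ hi f ∉ᵉ? e ] + [ lo f ∉ᵉ? e ] * [ hi f ∈ᵉ? e ]
adjacent-indicator ((a , b) , a<b) ((u , v) , u<v) with a ≟ u | b ≟ v | a ≟ v | b ≟ u
... | yes refl | _        | yes refl | _        = contradiction u<v (<-irrefl refl)
... | _        | yes refl | _        | yes refl = contradiction u<v (<-irrefl refl)
... | yes refl | _        | _        | yes refl = contradiction a<b (<-irrefl refl)
... | _        | yes refl | yes refl | _        = contradiction a<b (<-irrefl refl)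
... | _        | _        | yes refl | yes refl = contradiction a<b (<-asym u<v)
... | yes _    | yes _    | no _     | no _     = refl
... | yes _    | no _     | no _     | no _     = refl
... | no _     | yes _    | no _     | no _     = refl
... | no _     | no _     | yes _    | no _     = refl
... | no _     | no _     | no _     | yes _    = refl
... | no _     | no _     | no _     | no _     = refl

module _ {a p} {A : Set a} {P : Pred A p} (P? : Decidable P) where

  length-filter-concatMap : ∀ {b n} {B : Set b} (g : Fin n → B) (f : B → List A) →
    length (filter P? (concatMap f (tabulate g))) ≡ ∑[ i < n ] length (filter P? (f (g i)))
  length-filter-concatMap {n = zero}  g f = refl
  length-filter-concatMap {n = suc n} g f =
    trans (cong length (filter-++ P? (f (g fzero)) _))
          (trans (length-++ (filter P? (f (g fzero))))
                 (cong (length (filter P? (f (g fzero))) +_) (length-filter-concatMap (g ∘ fsuc) f)))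

  length-filter-[x] : ∀ x → length (filter P? (x ∷ [])) ≡ [ P? x ]
  length-filter-[x] x with P? x
  ... | yes _ = refl
  ... | no _  = refl

-- The helper with which Defs.edges turns a pair into an edge is local to its where-block;
-- unifying edges n against this shape (by refl) recovers it.
edgePick : (n : ℕ) → Fin n → Fin n → Maybe (Edge n)
edgePick n = pickOf refl
  where
  pickOf : {pick : Fin n → Fin n → Maybe (Edge n)} →
           edges n ≡ concatMap (λ u → mapMaybe (pick u) (allFin n)) (allFin n) → Fin n → Fin n → Maybe (Edge n)
  pickOf {pick} _ = pick

length-filter-edges : ∀ {n p} {P : Pred (Edge n) p} (P? : Decidable P) (Q : Fin n → Fin n → ℕ) →
  (∀ u v (u<v : u <ᶠ v) → [ P? ((u , v) , u<v) ] ≡ Q u v) →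
  length (filter P? (edges n)) ≡ ∑[ u < n ] ∑[ v < n ] ([ u <? v ] * Q u v)
length-filter-edges {n} P? Q P≡Q = begin
  length (filter P? (edges n))
    ≡⟨ length-filter-concatMap P? id (λ u → mapMaybe (edgePick n u) (allFin n)) ⟩
  ∑[ u < n ] length (filter P? (mapMaybe (edgePick n u) (allFin n)))
    ≡⟨ sum-cong-≗ (λ u → cong (length ∘ filter P?) (mapMaybe-concatMap (edgePick n u) (allFin n))) ⟩
  ∑[ u < n ] length (filter P? (concatMap (fromMaybe ∘ edgePick n u) (allFin n)))
    ≡⟨ sum-cong-≗ (λ u → length-filter-concatMap P? id (fromMaybe ∘ edgePick n u)) ⟩
  ∑[ u < n ] ∑[ v < n ] length (filter P? (fromMaybe (edgePick n u v)))
    ≡⟨ ∑∑-cong picked ⟩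
  ∑[ u < n ] ∑[ v < n ] ([ u <? v ] * Q u v) ∎
  where
  open ≡-Reasoning
  picked : ∀ u v → length (filter P? (fromMaybe (edgePick n u v))) ≡ [ u <? v ] * Q u v
  picked u v with u <? v
  ... | yes u<v = trans (length-filter-[x] P? _) (trans (P≡Q u v u<v) (sym (*-identityˡ (Q u v))))
  ... | no _    = refl

length-filter-adjacent : ∀ {n p} (e : Edge n) (H : Fin n → Fin n → ℕ) → (∀ u v → H u v ≡ H v u) →
  {P : Pred (Edge n) p} (P? : Decidable P) → (∀ f → [ P? f ] ≡ [ adjacent? e f ] * H (lo f) (hi f)) →
  length (filter P? (edges n)) ≡ ∑[ x < n ] ([ x ∉ᵉ? e ] * (H (lo e) x + H (hi e) x))
length-filter-adjacent {n} e H H-sym P? P≡adjH = begin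
  length (filter P? (edges n))
    ≡⟨ length-filter-edges P? (λ u v → F u v + F v u) one-endpoint ⟩
  ∑[ u < n ] ∑[ v < n ] ([ u <? v ] * (F u v + F v u))
    ≡⟨ ∑-<-symmetrise F F-diag ⟩
  ∑[ u < n ] ∑[ v < n ] F u v
    ≡⟨ sum-cong-≗ (λ u → *-distribˡ-sum [ u ∈ᵉ? e ] (λ v → [ v ∉ᵉ? e ] * H u v)) ⟨
  ∑[ u < n ] ([ u ∈ᵉ? e ] * ∑[ v < n ] ([ v ∉ᵉ? e ] * H u v))
    ≡⟨ ∑-∈ᵉ e (λ u → ∑[ v < n ] ([ v ∉ᵉ? e ] * H u v)) ⟩
  ∑[ v < n ] ([ v ∉ᵉ? e ] * H (lo e) v) + ∑[ v < n ] ([ v ∉ᵉ? e ] * H (hi e) v)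
    ≡⟨ ∑-distrib-+ (λ v → [ v ∉ᵉ? e ] * H (lo e) v) (λ v → [ v ∉ᵉ? e ] * H (hi e) v) ⟨
  ∑[ v < n ] ([ v ∉ᵉ? e ] * H (lo e) v + [ v ∉ᵉ? e ] * H (hi e) v)
    ≡⟨ sum-cong-≗ (λ v → *-distribˡ-+ [ v ∉ᵉ? e ] (H (lo e) v) (H (hi e) v)) ⟨
  ∑[ v < n ] ([ v ∉ᵉ? e ] * (H (lo e) v + H (hi e) v)) ∎
  where
  open ≡-Reasoning
  F : Fin n → Fin n → ℕ
  F u v = [ u ∈ᵉ? e ] * ([ v ∉ᵉ? e ] * H u v)

  F-diag : ∀ u → F u u ≡ 0
  F-diag u =
    trans (sym (*-assoc [ u ∈ᵉ? e ] [ u ∉ᵉ? e ] (H u u))) (cong (_* H u u) ([]*[¬]≡0 (u ∈ᵉ? e)))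

  one-endpoint : ∀ u v (u<v : u <ᶠ v) → [ P? ((u , v) , u<v) ] ≡ F u v + F v u
  one-endpoint u v u<v = begin
    [ P? f ]
      ≡⟨ P≡adjH f ⟩
    [ adjacent? e f ] * H u v
      ≡⟨ cong (_* H u v) (adjacent-indicator e f) ⟩
    ([ u ∈ᵉ? e ] * [ v ∉ᵉ? e ] + [ u ∉ᵉ? e ] * [ v ∈ᵉ? e ]) * H u v
      ≡⟨ regroup [ u ∈ᵉ? e ] [ v ∉ᵉ? e ] [ u ∉ᵉ? e ] [ v ∈ᵉ? e ] (H u v) ⟩
    F u v + [ v ∈ᵉ? e ] * ([ u ∉ᵉ? e ] * H u v)
      ≡⟨ cong (λ h → F u v + [ v ∈ᵉ? e ] * ([ u ∉ᵉ? e ] * h)) (H-sym u v) ⟩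
    F u v + F v u ∎
    where
    f = (u , v) , u<v
    regroup : ∀ a b c d h → (a * b + c * d) * h ≡ a * (b * h) + d * (c * h)
    regroup = solve-∀

edgeColouring : ∀ {n k} → (Fin n → Fin n → Fin k) → Edge n → Fin k
edgeColouring κ e = κ (lo e) (hi e)

adjDeg≡ : ∀ {n} (e : Edge n) → adjDeg e ≡ 2 * ∑[ x < n ] [ x ∉ᵉ? e ]
adjDeg≡ {n} e = begin
  adjDeg e
    ≡⟨ length-filter-adjacent e (λ _ _ → 1) (λ _ _ → refl) (adjacent? e) (λ f → sym (*-identityʳ _)) ⟩
  ∑[ x < n ] ([ x ∉ᵉ? e ] * 2)
    ≡⟨ sum-cong-≗ (λ x → *-comm [ x ∉ᵉ? e ] 2) ⟩
  ∑[ x < n ] (2 * [ x ∉ᵉ? e ])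
    ≡⟨ *-distribˡ-sum 2 (λ x → [ x ∉ᵉ? e ]) ⟨
  2 * ∑[ x < n ] [ x ∉ᵉ? e ] ∎
  where open ≡-Reasoning

adjColCount-edgeColouring : ∀ {n k} (κ : Fin n → Fin n → Fin k) → (∀ u v → κ u v ≡ κ v u) → ∀ e α →
  adjColCount (edgeColouring κ) e α ≡ ∑[ x < n ] ([ x ∉ᵉ? e ] * ([ κ (lo e) x ≟ α ] + [ κ (hi e) x ≟ α ]))
adjColCount-edgeColouring κ κ-sym e α =
  length-filter-adjacent e (λ u v → [ κ u v ≟ α ]) (λ u v → cong (λ c → [ c ≟ α ]) (κ-sym u v)) _
    (λ f → []-×-dec (adjacent? e f) (κ (lo f) (hi f) ≟ α))

mod3 : ℕ → Fin 3
mod3 0                   = fzero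
mod3 1                   = fsuc fzero
mod3 2                   = fsuc (fsuc fzero)
mod3 (suc (suc (suc m))) = mod3 m

_+₃_ : Fin 3 → Fin 3 → Fin 3
s +₃ t = mod3 (toℕ s + toℕ t)

+₃-comm : ∀ s t → s +₃ t ≡ t +₃ s
+₃-comm s t = cong mod3 (+-comm (toℕ s) (toℕ t))

+₃-cancelʳ : ∀ s t y → s +₃ y ≡ t +₃ y → s ≡ t
+₃-cancelʳ = from-yes (all? λ s → all? λ t → all? λ y → (s +₃ y ≟ t +₃ y) →-dec (s ≟ t))

∑-[+₃≟]≤1 : ∀ s α → ∑[ y < 3 ] [ s +₃ y ≟ α ] ≤ 1
∑-[+₃≟]≤1 = from-yes (all? λ s → all? λ α → ∑[ y < 3 ] [ s +₃ y ≟ α ] ≤? 1)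

3*∑-mod3≤ : (g : Fin 3 → ℕ) → ∑[ r < 3 ] g r ≤ 1 → ∀ n → 3 * ∑[ x < n ] g (mod3 (toℕ x)) ≤ n + 2
3*∑-mod3≤ g ∑g≤1 0 = z≤n
3*∑-mod3≤ g ∑g≤1 1 = *-monoʳ-≤ 3 (≤-trans (+-monoʳ-≤ (g fzero) z≤n) ∑g≤1)
3*∑-mod3≤ g ∑g≤1 2 =
  ≤-trans (*-monoʳ-≤ 3 (≤-trans (+-monoʳ-≤ (g fzero) (+-monoʳ-≤ (g (fsuc fzero)) z≤n)) ∑g≤1)) (n≤1+n 3)
3*∑-mod3≤ g ∑g≤1 (suc (suc (suc m))) = begin
  3 * (g₀ + (g₁ + (g₂ + S)))  ≡⟨ regroup g₀ g₁ g₂ S ⟩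
  3 * ∑[ r < 3 ] g r + 3 * S  ≤⟨ +-mono-≤ (*-monoʳ-≤ 3 ∑g≤1) (3*∑-mod3≤ g ∑g≤1 m) ⟩
  3 + (m + 2)                 ∎
  where
  open ≤-Reasoning
  g₀ = g fzero
  g₁ = g (fsuc fzero)
  g₂ = g (fsuc (fsuc fzero))
  S = ∑[ x < m ] g (mod3 (toℕ x))
  regroup : ∀ a b c s → 3 * (a + (b + (c + s))) ≡ 3 * (a + (b + (c + 0))) + 3 * s
  regroup = solve-∀

residue : ∀ {n} → Fin n → Fin 3
residue x = mod3 (toℕ x)

modColour : ∀ {n} → Fin n → Fin n → Fin 3
modColour u v = residue u +₃ residue v

modColouring : ∀ {n} → Edge n → Fin 3
modColouring = edgeColouring modColour

G+G≤O : ∀ G O {n} → 3 * G ≤ n + 2 → O + 2 ≡ n → 10 ≤ n → G + G ≤ O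
G+G≤O G O 3G≤O+4 refl 10≤O+2 = *-cancelˡ-≤ 3 (begin
  3 * (G + G)                ≡⟨ *-distribˡ-+ 3 G G ⟩
  3 * G + 3 * G              ≤⟨ +-mono-≤ 3G≤O+4 3G≤O+4 ⟩
  (O + 2 + 2) + (O + 2 + 2)  ≡⟨ regroup O ⟩
  2 * O + 8                  ≤⟨ +-monoʳ-≤ (2 * O) (+-cancelʳ-≤ 2 8 O 10≤O+2) ⟩
  2 * O + O                  ≡⟨ +-comm (2 * O) O ⟩
  3 * O                      ∎)
  where
  open ≤-Reasoning
  regroup : ∀ o → (o + 2 + 2) + (o + 2 + 2) ≡ 2 * o + 8
  regroup = solve-∀

modColour-count≤ : ∀ {n} → 10 ≤ n → (e : Edge n) (α : Fin 3) →
  ∑[ x < n ] ([ x ∉ᵉ? e ] * ([ modColour (lo e) x ≟ α ] + [ modColour (hi e) x ≟ α ]))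
    ≤ ∑[ x < n ] [ x ∉ᵉ? e ]
modColour-count≤ {n} 10≤n e α with residue (lo e) ≟ residue (hi e)
... | no ra≢rb =
  ∑-mono λ x → ≤-trans (*-monoʳ-≤ [ x ∉ᵉ? e ] (at-most-one x)) (≤-reflexive (*-identityʳ [ x ∉ᵉ? e ]))
  where
  at-most-one : ∀ x → [ modColour (lo e) x ≟ α ] + [ modColour (hi e) x ≟ α ] ≤ 1
  at-most-one x = []+[]≤1 (λ (a≡α , b≡α) → ra≢rb (+₃-cancelʳ _ _ (residue x) (trans a≡α (sym b≡α))))
                          (modColour (lo e) x ≟ α) (modColour (hi e) x ≟ α)
... | yes ra≡rb = begin
  ∑[ x < n ] ([ x ∉ᵉ? e ] * (g (residue x) + [ modColour (hi e) x ≟ α ]))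
    ≤⟨ ∑-mono (λ x → []*m≤m (x ∉ᵉ? e) (g (residue x) + [ modColour (hi e) x ≟ α ])) ⟩
  ∑[ x < n ] (g (residue x) + [ modColour (hi e) x ≟ α ])
    ≡⟨ sum-cong-≗ {n} (λ x → cong (λ r → g (residue x) + [ r +₃ residue x ≟ α ]) (sym ra≡rb)) ⟩
  ∑[ x < n ] (g (residue x) + g (residue x))
    ≡⟨ ∑-distrib-+ {n} (g ∘ residue) (g ∘ residue) ⟩
  ∑[ x < n ] g (residue x) + ∑[ x < n ] g (residue x)
    ≤⟨ G+G≤O (∑[ x < n ] g (residue x)) (∑[ x < n ] [ x ∉ᵉ? e ])
             (3*∑-mod3≤ g (∑-[+₃≟]≤1 (residue (lo e)) α) n) (∑-∉ᵉ e) 10≤n ⟩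
  ∑[ x < n ] [ x ∉ᵉ? e ] ∎
  where
  open ≤-Reasoning
  g : Fin 3 → ℕ
  g y = [ residue (lo e) +₃ y ≟ α ]

modColouring-isStrongMajority : ∀ {n} → 10 ≤ n → StrongMajority {n} modColouring
modColouring-isStrongMajority {n} 10≤n e α = begin
  2 * adjColCount modColouring e α
    ≡⟨ cong (2 *_) (adjColCount-edgeColouring modColour (λ u v → +₃-comm (residue u) (residue v)) e α) ⟩
  2 * ∑[ x < n ] ([ x ∉ᵉ? e ] * ([ modColour (lo e) x ≟ α ] + [ modColour (hi e) x ≟ α ]))
    ≤⟨ *-monoʳ-≤ 2 (modColour-count≤ 10≤n e α) ⟩
  2 * ∑[ x < n ] [ x ∉ᵉ? e ]
    ≡⟨ adjDeg≡ e ⟨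
  adjDeg e ∎
  where open ≤-Reasoning

∀-edge? : ∀ {n p} {P : Pred (Edge n) p} → Decidable P → Dec (∀ e → P e)
∀-edge? {n} {P = P} P? =
  map′ (λ ∀uv ((u , v) , u<v) → ∀uv u v u<v) (λ ∀e u v u<v → ∀e ((u , v) , u<v))
       (all? λ u → all? λ v → ∀-<? u v)
  where
  ∀-<? : ∀ u v → Dec (∀ (u<v : u <ᶠ v) → P ((u , v) , u<v))
  ∀-<? u v with u <? v
  ... | yes u<v = map′ (λ p u<v′ → subst (λ q → P ((u , v) , q)) (<-irrelevant u<v u<v′) p)
                       (λ ∀q → ∀q u<v) (P? ((u , v) , u<v))
  ... | no u≮v  = yes (λ u<v → contradiction u<v u≮v)

strongMajority? : ∀ {n k} (c : Edge n → Fin k) → Dec (StrongMajority c)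
strongMajority? c = ∀-edge? λ e → all? λ α → 2 * adjColCount c e α ≤? adjDeg e

byComputation : ∀ {n} (c : Edge n → Fin 3) → {True (strongMajority? c)} → MajIndexK≤ n 3
byComputation c {ok} = c , toWitness ok

-- Only the entries above the diagonal are read.
tableColouring : ∀ {n} → Vec (Vec ℕ n) n → Edge n → Fin 3
tableColouring t = edgeColouring λ u v → mod3 (lookup (lookup t u) v)

table₅ : Vec (Vec ℕ 5) 5
table₅ = (0 ∷ 0 ∷ 2 ∷ 0 ∷ 0 ∷ [])
       ∷ (0 ∷ 0 ∷ 2 ∷ 1 ∷ 1 ∷ [])
       ∷ (2 ∷ 2 ∷ 0 ∷ 1 ∷ 2 ∷ [])
       ∷ (0 ∷ 1 ∷ 1 ∷ 0 ∷ 1 ∷ [])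
       ∷ (0 ∷ 1 ∷ 2 ∷ 1 ∷ 0 ∷ [])
       ∷ []

-- Circulant: the colour of {u, v} is the cyclic distance between u and v minus one.
table₇ : Vec (Vec ℕ 7) 7
table₇ = (0 ∷ 0 ∷ 1 ∷ 2 ∷ 2 ∷ 1 ∷ 0 ∷ [])
       ∷ (0 ∷ 0 ∷ 0 ∷ 1 ∷ 2 ∷ 2 ∷ 1 ∷ [])
       ∷ (1 ∷ 0 ∷ 0 ∷ 0 ∷ 1 ∷ 2 ∷ 2 ∷ [])
       ∷ (2 ∷ 1 ∷ 0 ∷ 0 ∷ 0 ∷ 1 ∷ 2 ∷ [])
       ∷ (2 ∷ 2 ∷ 1 ∷ 0 ∷ 0 ∷ 0 ∷ 1 ∷ [])
       ∷ (1 ∷ 2 ∷ 2 ∷ 1 ∷ 0 ∷ 0 ∷ 0 ∷ [])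
       ∷ (0 ∷ 1 ∷ 2 ∷ 2 ∷ 1 ∷ 0 ∷ 0 ∷ [])
       ∷ []

mainTheorem8 : (n : ℕ) → n ≥ 3 → MajIndexK≤ n 3
mainTheorem8 0 ()
mainTheorem8 1 (s≤s ())
mainTheorem8 2 (s≤s (s≤s ()))
mainTheorem8 3 _ = byComputation modColouring
mainTheorem8 4 _ = byComputation modColouring
mainTheorem8 5 _ = byComputation (tableColouring table₅)
mainTheorem8 6 _ = byComputation modColouring
mainTheorem8 7 _ = byComputation (tableColouring table₇)
mainTheorem8 8 _ = byComputation modColouring
mainTheorem8 9 _ = byComputation modColouring
mainTheorem8 (suc (suc (suc (suc (suc (suc (suc (suc (suc (suc m)))))))))) _ =
  modColouring , modColouring-isStrongMajority (m≤m+n 10 m)
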